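{- If games $G_1$ and $G_2$ are miserable, then their disjunctive sum $G_1+G_2$ is miserable. Moreover, a position $x=(x_1,x_2)$ of $G_1+G_2$ is a swap position if and only if $x_i$ is a swap position of $G_i$ for $i=1,2$; and $x$ is a $(1,0)$-position of $G_1+G_2$ if and only if one of $x_1,x_2$ is a $(1,0)$-position (in its game) and the other is a $(0,1)$-position (in its game).
   Context: A game is a two-player impartial game given by a directed acyclic graph whose vertices are positions and whose arcs are moves, such that from every position only finitely many positions are reachable. A position with no moves is terminal. $\operatorname{mex}(S)$ is the least non-negative integer not in $S$. The normal Sprague–Grundy function is $\mathcal{G}(x)=\operatorname{mex}\{\mathcal{G}(y): x\to y\}$ (so $0$ on terminal positions); the misère Sprague–Grundy function $\mathcal{G}^-$ satisfies $\mathcal{G}^-(x)=1$ for terminal $x$ and $\mathcal{G}^-(x)=\operatorname{mex}\{\mathcal{G}^-(y): x\to y\}$ otherwise. An $(i,j)$-position is a position $x$ with $\mathcal{G}(x)=i$, $\mathcal{G}^-(x)=j$, and $V_{i,j}$ the set of them; a swap position is a position in $V_{0,1}\cup V_{1,0}$. A position $x$ is movable to a set $W$ if there is a move from $x$ to some position of $W$. A game is miserable if every position $x$ satisfies at least one of: (a) $x$ is a swap position; (b) $x$ is not movable to $V_{0,1}\cup V_{1,0}$; (c) $x$ is movable to $V_{0,1}$ and to $V_{1,0}$. The disjunctive sum $G_1+G_2$ has positions $(x_1,x_2)$ with $x_i$ a position of $G_i$; a move consists of choosing one $i$ and making a move $x_i\to x_i'$ in $G_i$, leaving the other coordinate unchanged.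 The functions $\mathcal{G},\mathcal{G}^-$ of the sum are computed in the sum itself (so a position of the sum is terminal iff both coordinates are terminal). -}

module Defs where

open import Data.Nat using (ℕ; zero; suc)
open import Data.Nat.Properties using (_≟_)
open import Data.List using (List; []; _∷_; length; map; _++_)
open import Data.List.Membership.Propositional using (_∈_; mapWith∈)
open import Data.List.Membership.Propositional.Properties using (∈-map⁻; ∈-++⁻)
open import Data.List.Membership.DecPropositional _≟_ using (_∈?_)
open import Data.Product using (Σ; ∃; _×_; _,_)
open import Data.Sum using (_⊎_; inj₁; inj₂)
open import Relation.Nullary using (¬_; yes; no)
open import Relation.Binary.PropositionalEquality using (_≡_; refl)
open import Induction.WellFounded using (WellFounded; Acc; acc)

-- mex: least natural number not in the list.
-- Searches 0,1,2,... ; at most length s + 1 candidates are needed,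
-- since some n ≤ length s is missing from s.

mexFrom : List ℕ → ℕ → ℕ → ℕ
mexFrom s zero    n = n
mexFrom s (suc f) n with n ∈? s
... | yes _ = mexFrom s f (suc n)
... | no  _ = n

mex : List ℕ → ℕ
mex s = mexFrom s (length s) 0

ifTerminal : ∀ {A : Set} → List A → ℕ → ℕ → ℕ
ifTerminal []      a b = a
ifTerminal (_ ∷ _) a b = b

record Game : Set₁ where
  field
    Pos   : Set
    moves : Pos → List Pos
  _⟵_ : Pos → Pos → Set
  y ⟵ x = y ∈ moves x
  field
    wf : WellFounded _⟵_

open Game public

module _ (G : Game) where
  private
    P = Pos G
    R = _⟵_ G

  grundyAcc : (x : P) → Acc R x → ℕ
  grundyAcc x (acc rs) = mex (mapWith∈ (moves G x) (λ {y} y∈ → grundyAcc y (rs y∈)))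

  grundy : P → ℕ
  grundy x = grundyAcc x (wf G x)

  misereAcc : (x : P) → Acc R x → ℕ
  misereAcc x (acc rs) = ifTerminal (moves G x) 1 (mex (mapWith∈ (moves G x) (λ {y} y∈ → misereAcc y (rs y∈))))

  misere : P → ℕ
  misere x = misereAcc x (wf G x)

  V : ℕ → ℕ → P → Set
  V i j x = grundy x ≡ i × misere x ≡ j

  Swap : P → Set
  Swap x = V 0 1 x ⊎ V 1 0 x

  MovableTo : (P → Set) → P → Set
  MovableTo W x = ∃ λ y → y ∈ moves G x × W y

  Miserable : Set
  Miserable = ∀ x → Swap x ⊎ (¬ MovableTo Swap x ⊎ (MovableTo (V 0 1) x × MovableTo (V 1 0) x))

module _ (G₁ G₂ : Game) where
  private
    P₁ = Pos G₁
    P₂ = Pos G₂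

  sumMoves : P₁ × P₂ → List (P₁ × P₂)
  sumMoves (x₁ , x₂) = map (λ y → (y , x₂)) (moves G₁ x₁) ++ map (λ y → (x₁ , y)) (moves G₂ x₂)

  private
    Rs : P₁ × P₂ → P₁ × P₂ → Set
    Rs y x = y ∈ sumMoves x

    accSum : ∀ {x₁ x₂} → Acc (_⟵_ G₁) x₁ → Acc (_⟵_ G₂) x₂ → Acc Rs (x₁ , x₂)
    accSum {x₁} {x₂} (acc r₁) (acc r₂) = acc step
      where
      step : ∀ {y} → Rs y (x₁ , x₂) → Acc Rs y
      step {y} p with ∈-++⁻ (map (λ y → (y , x₂)) (moves G₁ x₁)) p
      ... | inj₁ q with ∈-map⁻ (λ y → (y , x₂)) q
      ...   | y₁ , y₁∈ , refl = accSum (r₁ y₁∈) (acc r₂)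
      step {y} p | inj₂ q with ∈-map⁻ (λ y → (x₁ , y)) q
      ...   | y₂ , y₂∈ , refl = accSum (acc r₁) (r₂ y₂∈)

    wfSum : WellFounded Rs
    wfSum (x₁ , x₂) = accSum (wf G₁ x₁) (wf G₂ x₂)

  _⊕_ : Game
  _⊕_ = record { Pos = P₁ × P₂ ; moves = sumMoves ; wf = wfSum }

-- In a miserable game every position is a swap position or has equal normal and misère
-- values: at a non-swap position every swap option comes together with a (0,1)- and a
-- (1,0)-option, so the normal and misère values of the options form the same set.
-- For a sum only two instances of the Sprague–Grundy theorem are needed: the value is 0
-- iff the components have equal values, and 1 iff they differ by xor 1.  An induction over
-- the sum then shows that a position whose components are both swap positions is itself a
-- swap position, while every other position has equal normal and misère values; this
-- yields the miserability of the sum and the description of its (1,0)-positions.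
module Submission where

open import Defs
open import Level using (0ℓ)
open import Data.Nat using (ℕ; zero; suc; _<_; _≤_; _≰_; _+_; z≤n; s≤s; s≤s⁻¹; _≟_)
open import Data.Nat.Properties
  using (0≢1+n; suc-injective; <-cmp; m<1+n⇒m<n∨m≡n; ≮⇒≥; <⇒≢; 1+n≰n; +-identityʳ; +-suc; ≤-antisym; ≤-trans; ≤∧≢⇒<; ≰⇒>; <⇒≱)
open import Data.Fin using (toℕ)
open import Data.Fin.Properties using (pigeonhole; toℕ<n)
open import Data.List using (List; []; _∷_; length; map; lookup)
open import Data.List.Relation.Unary.Any using (here; there; index; any?)
open import Data.List.Relation.Unary.Any.Properties using (lookup-index)
open import Data.List.Membership.Propositional using (_∈_; _∉_; find; lose)
open import Data.List.Membership.Propositional.Properties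
  using (∈-map⁺; ∈-map⁻; ∈-++⁺ˡ; ∈-++⁺ʳ; ∈-++⁻; mapWith∈-cong; mapWith∈≗map)
open import Data.List.Membership.DecPropositional _≟_ using (_∈?_)
open import Data.List.Relation.Binary.Subset.Propositional using (_⊆_)
open import Data.Product using (∃; _×_; _,_; proj₁; proj₂)
open import Data.Sum using (_⊎_; inj₁; inj₂)
open import Data.Empty using (⊥-elim)
open import Function.Base using (_∘_)
open import Function.Bundles using (_⇔_; mk⇔; Equivalence)
open Equivalence using (to; from)
open import Relation.Nullary using (¬_; yes; no)
open import Relation.Nullary.Decidable using (_×-dec_; _⊎-dec_; map′)
open import Relation.Unary using (Decidable)
open import Relation.Binary.Definitions using (tri<; tri≈; tri>)
open import Relation.Binary.PropositionalEquality
  using (_≡_; _≢_; refl; sym; trans; cong; subst; module ≡-Reasoning)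
open import Induction.WellFounded using (Acc; acc; module All)

Below : ℕ → List ℕ → Set
Below n s = ∀ {k} → k < n → k ∈ s

Below-suc : ∀ {n s} → Below n s → n ∈ s → Below (suc n) s
Below-suc below n∈s k<1+n with m<1+n⇒m<n∨m≡n k<1+n
... | inj₁ k<n  = below k<n
... | inj₂ refl = n∈s

-- Pigeonhole: two of 0, …, n-1 would share a position in s.
Below⇒≤length : ∀ {n} s → Below n s → n ≤ length s
Below⇒≤length s below = ≮⇒≥ λ length<n →
  let i , j , i<j , same-index = pigeonhole length<n (λ i → index (below (toℕ<n i)))
  in <⇒≢ i<j (trans (lookup-index (below (toℕ<n i)))
                (trans (cong (lookup s) same-index) (sym (lookup-index (below (toℕ<n j))))))

mexFrom-spec : ∀ s fuel n → Below n s → n + fuel ≡ length s →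
               mexFrom s fuel n ∉ s × Below (mexFrom s fuel n) s
mexFrom-spec s zero n below n+0≡length =
  (λ n∈s → 1+n≰n (subst (suc n ≤_) (trans (sym n+0≡length) (+-identityʳ n))
                                   (Below⇒≤length s (Below-suc below n∈s))))
  , below
mexFrom-spec s (suc fuel) n below eq with n ∈? s
... | yes n∈s = mexFrom-spec s fuel (suc n) (Below-suc below n∈s) (trans (sym (+-suc n fuel)) eq)
... | no  n∉s = n∉s , below

mex-∉ : ∀ s → mex s ∉ s
mex-∉ s = proj₁ (mexFrom-spec s (length s) 0 (λ ()) refl)

mex-Below : ∀ s → Below (mex s) s
mex-Below s = proj₂ (mexFrom-spec s (length s) 0 (λ ()) refl)

mex-unique : ∀ s {n} → n ∉ s → Below n s → mex s ≡ n
mex-unique s n∉s below = ≤-antisym (≮⇒≥ (n∉s ∘ mex-Below s)) (≮⇒≥ (mex-∉ s ∘ below))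

mex-cong : ∀ {s t} → s ⊆ t → t ⊆ s → mex s ≡ mex t
mex-cong {s} {t} s⊆t t⊆s = mex-unique s (mex-∉ t ∘ s⊆t) (t⊆s ∘ mex-Below t)

module _ {A : Set} (f : A → ℕ) (xs : List A) where

  mex-map-∉ : ∀ {y} → y ∈ xs → f y ≢ mex (map f xs)
  mex-map-∉ y∈xs eq = mex-∉ (map f xs) (subst (_∈ map f xs) eq (∈-map⁺ f y∈xs))

  mex-map-Below : ∀ {k} → k < mex (map f xs) → ∃ λ y → y ∈ xs × f y ≡ k
  mex-map-Below k<mex = let y , y∈xs , k≡fy = ∈-map⁻ f (mex-Below (map f xs) k<mex) in y , y∈xs , sym k≡fy

  mex-map-unique : ∀ {n} → (∀ {y} → y ∈ xs → f y ≢ n) → (∀ {k} → k < n → ∃ λ y → y ∈ xs × f y ≡ k) →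
                   mex (map f xs) ≡ n
  mex-map-unique avoids reaches = mex-unique (map f xs)
    (λ n∈ → let y , y∈xs , n≡fy = ∈-map⁻ f n∈ in avoids y∈xs (sym n≡fy))
    (λ k<n → let y , y∈xs , fy≡k = reaches k<n in subst (_∈ map f xs) fy≡k (∈-map⁺ f y∈xs))

-- flip n is n xor 1.
flip : ℕ → ℕ
flip 0             = 1
flip 1             = 0
flip (suc (suc n)) = suc (suc (flip n))

flip-involutive : ∀ n → flip (flip n) ≡ n
flip-involutive 0             = refl
flip-involutive 1             = refl
flip-involutive (suc (suc n)) = cong (suc ∘ suc) (flip-involutive n)

flip-injective : ∀ {m n} → flip m ≡ flip n → m ≡ n
flip-injective {m} {n} eq = trans (sym (flip-involutive m)) (trans (cong flip eq) (flip-involutive n))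

flip-sym : ∀ {m n} → m ≡ flip n → n ≡ flip m
flip-sym {n = n} refl = sym (flip-involutive n)

flip-≢ : ∀ n → flip n ≢ n
flip-≢ 0             ()
flip-≢ 1             ()
flip-≢ (suc (suc n)) eq = flip-≢ n (suc-injective (suc-injective eq))

flip-≤ : ∀ n → flip n ≤ suc n
flip-≤ 0             = s≤s z≤n
flip-≤ 1             = z≤n
flip-≤ (suc (suc n)) = s≤s (s≤s (flip-≤ n))

<flip⇒≤ : ∀ {m n} → m < flip n → m ≤ n
<flip⇒≤ {n = n} m<flip = s≤s⁻¹ (≤-trans m<flip (flip-≤ n))

flip-≤1 : ∀ {n} → n ≤ 1 → flip n ≤ 1
flip-≤1 z≤n       = s≤s z≤n
flip-≤1 (s≤s z≤n) = z≤n

flip-≤1⁻¹ : ∀ {n} → flip n ≤ 1 → n ≤ 1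
flip-≤1⁻¹ {0}           _         = z≤n
flip-≤1⁻¹ {1}           _         = s≤s z≤n
flip-≤1⁻¹ {suc (suc n)} (s≤s ())

≤1-cases : ∀ {n} → n ≤ 1 → n ≡ 0 ⊎ n ≡ 1
≤1-cases z≤n       = inj₁ refl
≤1-cases (s≤s z≤n) = inj₂ refl

≤1-≢⇒flip : ∀ {m n} → m ≤ 1 → n ≤ 1 → m ≢ n → n ≡ flip m
≤1-≢⇒flip z≤n       z≤n       0≢0 = ⊥-elim (0≢0 refl)
≤1-≢⇒flip z≤n       (s≤s z≤n) _   = refl
≤1-≢⇒flip (s≤s z≤n) z≤n       _   = refl
≤1-≢⇒flip (s≤s z≤n) (s≤s z≤n) 1≢1 = ⊥-elim (1≢1 refl)

<flip-≤1 : ∀ {k n} → n ≤ 1 → k < flip n → k ≡ n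
<flip-≤1 z≤n       (s≤s z≤n) = refl
<flip-≤1 (s≤s z≤n) ()

ifTerminal-∈ : ∀ {A : Set} {l : List A} {y a b} → y ∈ l → ifTerminal l a b ≡ b
ifTerminal-∈ (here _)  = refl
ifTerminal-∈ (there _) = refl

module _ (G : Game) where

  grundyAcc-unfold : ∀ x (p : Acc (_⟵_ G) x) → grundyAcc G x p ≡ mex (map (grundy G) (moves G x))
  grundyAcc-unfold x (acc rs) = cong mex (trans
    (mapWith∈-cong (moves G x) _ _ λ y∈ → grundyAcc-irrelevant _ (rs y∈) (wf G _))
    (mapWith∈≗map (grundy G) (moves G x)))
    where
    grundyAcc-irrelevant : ∀ x (p q : Acc (_⟵_ G) x) → grundyAcc G x p ≡ grundyAcc G x q
    grundyAcc-irrelevant x (acc rs) (acc rs′) =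
      cong mex (mapWith∈-cong (moves G x) _ _ λ y∈ → grundyAcc-irrelevant _ (rs y∈) (rs′ y∈))

  misereAcc-unfold : ∀ x (p : Acc (_⟵_ G) x) →
                     misereAcc G x p ≡ ifTerminal (moves G x) 1 (mex (map (misere G) (moves G x)))
  misereAcc-unfold x (acc rs) = cong (ifTerminal (moves G x) 1 ∘ mex) (trans
    (mapWith∈-cong (moves G x) _ _ λ y∈ → misereAcc-irrelevant _ (rs y∈) (wf G _))
    (mapWith∈≗map (misere G) (moves G x)))
    where
    misereAcc-irrelevant : ∀ x (p q : Acc (_⟵_ G) x) → misereAcc G x p ≡ misereAcc G x q
    misereAcc-irrelevant x (acc rs) (acc rs′) = cong (ifTerminal (moves G x) 1 ∘ mex)
      (mapWith∈-cong (moves G x) _ _ λ y∈ → misereAcc-irrelevant _ (rs y∈) (rs′ y∈))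

  grundy-unfold : ∀ x → grundy G x ≡ mex (map (grundy G) (moves G x))
  grundy-unfold x = grundyAcc-unfold x (wf G x)

  misere-unfold : ∀ x → misere G x ≡ ifTerminal (moves G x) 1 (mex (map (misere G) (moves G x)))
  misere-unfold x = misereAcc-unfold x (wf G x)

  Terminal : Pos G → Set
  Terminal x = moves G x ≡ []

  NonTerminal : Pos G → Set
  NonTerminal x = ∃ λ y → y ∈ moves G x

  terminal? : ∀ x → Terminal x ⊎ NonTerminal x
  terminal? x with moves G x
  ... | []    = inj₁ refl
  ... | y ∷ _ = inj₂ (y , here refl)

  terminal⇒V01 : ∀ {x} → Terminal x → V G 0 1 x
  terminal⇒V01 {x} t =
    trans (grundy-unfold x) (cong (mex ∘ map (grundy G)) t) ,
    trans (misere-unfold x) (cong (λ l → ifTerminal l 1 (mex (map (misere G) l))) t)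

  misere-nonterminal : ∀ {x} → NonTerminal x → misere G x ≡ mex (map (misere G) (moves G x))
  misere-nonterminal {x} (_ , y∈) = trans (misere-unfold x) (ifTerminal-∈ y∈)

  module OptionValues (f : Pos G → ℕ) {x} (f-unfold : f x ≡ mex (map f (moves G x))) where

    option-≢ : ∀ {y} → y ∈ moves G x → f y ≢ f x
    option-≢ y∈ eq = mex-map-∉ f (moves G x) y∈ (trans eq f-unfold)

    movableTo-< : ∀ {k} → k < f x → MovableTo G (λ y → f y ≡ k) x
    movableTo-< k<fx = mex-map-Below f (moves G x) (subst (_ <_) f-unfold k<fx)

    ≡-intro : ∀ {n} → (∀ {y} → y ∈ moves G x → f y ≢ n) →
              (∀ {k} → k < n → MovableTo G (λ y → f y ≡ k) x) → f x ≡ n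
    ≡-intro avoids reaches = trans f-unfold (mex-map-unique f (moves G x) avoids reaches)

  grundy-option-≢ : ∀ {x y} → y ∈ moves G x → grundy G y ≢ grundy G x
  grundy-option-≢ {x} = OptionValues.option-≢ (grundy G) (grundy-unfold x)

  grundy-movableTo-< : ∀ {x k} → k < grundy G x → MovableTo G (λ y → grundy G y ≡ k) x
  grundy-movableTo-< {x} = OptionValues.movableTo-< (grundy G) (grundy-unfold x)

  grundy-intro : ∀ {x n} → (∀ {y} → y ∈ moves G x → grundy G y ≢ n) →
                 (∀ {k} → k < n → MovableTo G (λ y → grundy G y ≡ k) x) → grundy G x ≡ n
  grundy-intro {x} = OptionValues.≡-intro (grundy G) (grundy-unfold x)

  misere-option-≢ : ∀ {x y} → y ∈ moves G x → misere G y ≢ misere G x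
  misere-option-≢ y∈ = OptionValues.option-≢ (misere G) (misere-nonterminal (_ , y∈)) y∈

  misere-movableTo-< : ∀ {x k} → NonTerminal x → k < misere G x → MovableTo G (λ y → misere G y ≡ k) x
  misere-movableTo-< nt = OptionValues.movableTo-< (misere G) (misere-nonterminal nt)

  misere-intro : ∀ {x n} → NonTerminal x → (∀ {y} → y ∈ moves G x → misere G y ≢ n) →
                 (∀ {k} → k < n → MovableTo G (λ y → misere G y ≡ k) x) → misere G x ≡ n
  misere-intro nt = OptionValues.≡-intro (misere G) (misere-nonterminal nt)

  swap? : Decidable (Swap G)
  swap? x = (grundy G x ≟ 0 ×-dec misere G x ≟ 1) ⊎-dec (grundy G x ≟ 1 ×-dec misere G x ≟ 0)

  movableTo? : ∀ {W} → Decidable W → Decidable (MovableTo G W)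
  movableTo? W? x = map′ find (λ (_ , y∈ , wy) → lose y∈ wy) (any? W? (moves G x))

  swap-grundy≤1 : ∀ {x} → Swap G x → grundy G x ≤ 1
  swap-grundy≤1 (inj₁ (g≡0 , _)) = subst (_≤ 1) (sym g≡0) z≤n
  swap-grundy≤1 (inj₂ (g≡1 , _)) = subst (_≤ 1) (sym g≡1) (s≤s z≤n)

  swap-misere≡flip : ∀ {x} → Swap G x → misere G x ≡ flip (grundy G x)
  swap-misere≡flip (inj₁ (g≡0 , m≡1)) = trans m≡1 (cong flip (sym g≡0))
  swap-misere≡flip (inj₂ (g≡1 , m≡0)) = trans m≡0 (cong flip (sym g≡1))

  swap-misere≤1 : ∀ {x} → Swap G x → misere G x ≤ 1
  swap-misere≤1 s = subst (_≤ 1) (sym (swap-misere≡flip s)) (flip-≤1 (swap-grundy≤1 s))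

  swap-intro : ∀ {x} → grundy G x ≤ 1 → misere G x ≡ flip (grundy G x) → Swap G x
  swap-intro g≤1 m≡flip with ≤1-cases g≤1
  ... | inj₁ g≡0 = inj₁ (g≡0 , trans m≡flip (cong flip g≡0))
  ... | inj₂ g≡1 = inj₂ (g≡1 , trans m≡flip (cong flip g≡1))

  swap⇒grundy≢misere : ∀ {x} → Swap G x → grundy G x ≢ misere G x
  swap⇒grundy≢misere {x} s g≡m = flip-≢ (grundy G x) (trans (sym (swap-misere≡flip s)) (sym g≡m))

  swap-V10 : ∀ {x} → Swap G x → grundy G x ≢ 0 → V G 1 0 x
  swap-V10 (inj₁ (g≡0 , _)) g≢0 = ⊥-elim (g≢0 g≡0)
  swap-V10 (inj₂ v)         _   = v

  nonswap⇒nonterminal : ∀ {x} → ¬ Swap G x → NonTerminal x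
  nonswap⇒nonterminal {x} ¬s with terminal? x
  ... | inj₁ t  = ⊥-elim (¬s (inj₁ (terminal⇒V01 t)))
  ... | inj₂ nt = nt

  movableTo-V01×V10 : ∀ {x y₀ y₁} → y₀ ∈ moves G x → y₁ ∈ moves G x → Swap G y₀ → Swap G y₁ →
                      grundy G y₀ ≢ grundy G y₁ → MovableTo G (V G 0 1) x × MovableTo G (V G 1 0) x
  movableTo-V01×V10 p₀ p₁ (inj₁ v₀) (inj₂ v₁) _ = (_ , p₀ , v₀) , (_ , p₁ , v₁)
  movableTo-V01×V10 p₀ p₁ (inj₂ v₀) (inj₁ v₁) _ = (_ , p₁ , v₁) , (_ , p₀ , v₀)
  movableTo-V01×V10 p₀ p₁ (inj₁ v₀) (inj₁ v₁) g≢ = ⊥-elim (g≢ (trans (proj₁ v₀) (sym (proj₁ v₁))))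
  movableTo-V01×V10 p₀ p₁ (inj₂ v₀) (inj₂ v₁) g≢ = ⊥-elim (g≢ (trans (proj₁ v₀) (sym (proj₁ v₁))))

  -- The options then have the same Grundy values as misère values: a swap option only
  -- contributes 0 and 1, which the (0,1)- and (1,0)-options supply to both sets.
  grundy≡misere : ∀ {x} → NonTerminal x →
                  (∀ {y} → y ∈ moves G x → Swap G y ⊎ grundy G y ≡ misere G y) →
                  (MovableTo G (Swap G) x → MovableTo G (V G 0 1) x × MovableTo G (V G 1 0) x) →
                  grundy G x ≡ misere G x
  grundy≡misere {x} nt options swap⇒both = begin
    grundy G x                        ≡⟨ grundy-unfold x ⟩
    mex (map (grundy G) (moves G x))  ≡⟨ mex-cong (values-⊆ grundy∈misere) (values-⊆ misere∈grundy) ⟩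
    mex (map (misere G) (moves G x))  ≡⟨ misere-nonterminal nt ⟨
    misere G x                        ∎
    where
    open ≡-Reasoning

    values-⊆ : ∀ {f h : Pos G → ℕ} → (∀ {y} → y ∈ moves G x → f y ∈ map h (moves G x)) →
               map f (moves G x) ⊆ map h (moves G x)
    values-⊆ {f} fy∈ v∈ = let y , y∈ , v≡fy = ∈-map⁻ f v∈ in subst (_∈ _) (sym v≡fy) (fy∈ y∈)

    bits∈ : MovableTo G (V G 0 1) x × MovableTo G (V G 1 0) x → ∀ {v} → v ≤ 1 →
            v ∈ map (grundy G) (moves G x) × v ∈ map (misere G) (moves G x)
    bits∈ ((y₀ , p₀ , g₀ , m₀) , (y₁ , p₁ , g₁ , m₁)) z≤n =
      subst (_∈ _) g₀ (∈-map⁺ (grundy G) p₀) , subst (_∈ _) m₁ (∈-map⁺ (misere G) p₁)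
    bits∈ ((y₀ , p₀ , g₀ , m₀) , (y₁ , p₁ , g₁ , m₁)) (s≤s z≤n) =
      subst (_∈ _) g₁ (∈-map⁺ (grundy G) p₁) , subst (_∈ _) m₀ (∈-map⁺ (misere G) p₀)

    grundy∈misere : ∀ {y} → y ∈ moves G x → grundy G y ∈ map (misere G) (moves G x)
    grundy∈misere y∈ with options y∈
    ... | inj₁ sy  = proj₂ (bits∈ (swap⇒both (_ , y∈ , sy)) (swap-grundy≤1 sy))
    ... | inj₂ g≡m = subst (_∈ _) (sym g≡m) (∈-map⁺ (misere G) y∈)

    misere∈grundy : ∀ {y} → y ∈ moves G x → misere G y ∈ map (grundy G) (moves G x)
    misere∈grundy y∈ with options y∈
    ... | inj₁ sy  = proj₁ (bits∈ (swap⇒both (_ , y∈ , sy)) (swap-misere≤1 sy))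
    ... | inj₂ g≡m = subst (_∈ _) g≡m (∈-map⁺ (grundy G) y∈)

module _ (G : Game) (M : Miserable G) where

  miserable-movableTo : ∀ {x} → ¬ Swap G x → MovableTo G (Swap G) x →
                        MovableTo G (V G 0 1) x × MovableTo G (V G 1 0) x
  miserable-movableTo {x} ¬sx mv with M x
  ... | inj₁ sx          = ⊥-elim (¬sx sx)
  ... | inj₂ (inj₁ ¬mv)  = ⊥-elim (¬mv mv)
  ... | inj₂ (inj₂ both) = both

  swap⊎grundy≡misere : ∀ x → Swap G x ⊎ grundy G x ≡ misere G x
  swap⊎grundy≡misere = All.wfRec (wf G) 0ℓ _ step
    where
    step : ∀ x → (∀ {y} → y ∈ moves G x → Swap G y ⊎ grundy G y ≡ misere G y) →
           Swap G x ⊎ grundy G x ≡ misere G x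
    step x ih with swap? G x
    ... | yes sx  = inj₁ sx
    ... | no  ¬sx = inj₂ (grundy≡misere G (nonswap⇒nonterminal G ¬sx) ih (miserable-movableTo ¬sx))

  swap-option : ∀ {x y} → Swap G x → y ∈ moves G x → Swap G y ⊎ 1 < grundy G y
  swap-option {x} {y} sx y∈ with swap⊎grundy≡misere y
  ... | inj₁ sy  = inj₁ sy
  ... | inj₂ g≡m = inj₂ (≰⇒> g≰1)
    where
    g≰1 : grundy G y ≰ 1
    g≰1 gy≤1 = misere-option-≢ G y∈ (trans (sym g≡m) (trans
      (≤1-≢⇒flip (swap-grundy≤1 G sx) gy≤1 (grundy-option-≢ G y∈ ∘ sym))
      (sym (swap-misere≡flip G sx))))

  swap⇒movableTo-swap : ∀ {x} → Swap G x → NonTerminal G x → MovableTo G (Swap G) x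
  swap⇒movableTo-swap (inj₁ (g≡0 , m≡1)) nt
    with y , y∈ , my≡0 ← misere-movableTo-< G nt (subst (0 <_) (sym m≡1) (s≤s z≤n))
    with swap⊎grundy≡misere y
  ... | inj₁ sy  = y , y∈ , sy
  ... | inj₂ g≡m = ⊥-elim (grundy-option-≢ G y∈ (trans (trans g≡m my≡0) (sym g≡0)))
  swap⇒movableTo-swap (inj₂ (g≡1 , m≡0)) nt
    with y , y∈ , gy≡0 ← grundy-movableTo-< G (subst (0 <_) (sym g≡1) (s≤s z≤n))
    with swap⊎grundy≡misere y
  ... | inj₁ sy  = y , y∈ , sy
  ... | inj₂ g≡m = ⊥-elim (misere-option-≢ G y∈ (trans (sym g≡m) (trans gy≡0 (sym m≡0))))

module _ (G₁ G₂ : Game) where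

  private
    S : Game
    S = G₁ ⊕ G₂

  data ⊕-Move (a : Pos G₁) (b : Pos G₂) : Pos G₁ × Pos G₂ → Set where
    left  : ∀ {a′} → a′ ∈ moves G₁ a → ⊕-Move a b (a′ , b)
    right : ∀ {b′} → b′ ∈ moves G₂ b → ⊕-Move a b (a , b′)

  ⊕-moveˡ : ∀ {a a′ b} → a′ ∈ moves G₁ a → (a′ , b) ∈ moves S (a , b)
  ⊕-moveˡ {b = b} a′∈ = ∈-++⁺ˡ (∈-map⁺ (_, b) a′∈)

  ⊕-moveʳ : ∀ {a b b′} → b′ ∈ moves G₂ b → (a , b′) ∈ moves S (a , b)
  ⊕-moveʳ {a} {b} b′∈ = ∈-++⁺ʳ (map (_, b) (moves G₁ a)) (∈-map⁺ (a ,_) b′∈)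

  ⊕-move-view : ∀ {a b y} → y ∈ moves S (a , b) → ⊕-Move a b y
  ⊕-move-view {a} {b} y∈ with ∈-++⁻ (map (_, b) (moves G₁ a)) y∈
  ... | inj₁ p with a′ , a′∈ , refl ← ∈-map⁻ (_, b) p = left a′∈
  ... | inj₂ p with b′ , b′∈ , refl ← ∈-map⁻ (a ,_) p = right b′∈

  ⊕-nonterminal⁻ : ∀ {a b} → NonTerminal S (a , b) → NonTerminal G₁ a ⊎ NonTerminal G₂ b
  ⊕-nonterminal⁻ (_ , y∈) with ⊕-move-view y∈
  ... | left  a′∈ = inj₁ (_ , a′∈)
  ... | right b′∈ = inj₂ (_ , b′∈)

  ⊕-nonterminal : ∀ {a b} → ¬ (Swap G₁ a × Swap G₂ b) → NonTerminal S (a , b)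
  ⊕-nonterminal {a} ¬both with swap? G₁ a
  ... | no ¬sa = let _ , a′∈ = nonswap⇒nonterminal G₁ ¬sa in _ , ⊕-moveˡ a′∈
  ... | yes sa = let _ , b′∈ = nonswap⇒nonterminal G₂ (¬both ∘ (sa ,_)) in _ , ⊕-moveʳ b′∈

  private
    ZeroRule : Pos G₁ × Pos G₂ → Set
    ZeroRule (a , b) = grundy S (a , b) ≡ 0 ⇔ grundy G₁ a ≡ grundy G₂ b

    movableTo-0 : ∀ {a b} → (∀ {y} → y ∈ moves S (a , b) → ZeroRule y) →
                  grundy G₁ a ≢ grundy G₂ b → MovableTo S (λ y → grundy S y ≡ 0) (a , b)
    movableTo-0 {a} {b} ih g₁≢g₂ with <-cmp (grundy G₁ a) (grundy G₂ b)
    ... | tri< g₁<g₂ _ _ = let _ , b′∈ , g₂≡g₁ = grundy-movableTo-< G₂ g₁<g₂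
                           in _ , ⊕-moveʳ b′∈ , from (ih (⊕-moveʳ b′∈)) (sym g₂≡g₁)
    ... | tri≈ _ g₁≡g₂ _ = ⊥-elim (g₁≢g₂ g₁≡g₂)
    ... | tri> _ _ g₂<g₁ = let _ , a′∈ , g₁≡g₂ = grundy-movableTo-< G₁ g₂<g₁
                           in _ , ⊕-moveˡ a′∈ , from (ih (⊕-moveˡ a′∈)) g₁≡g₂

  grundy-⊕≡0⇔ : ∀ a b → grundy S (a , b) ≡ 0 ⇔ grundy G₁ a ≡ grundy G₂ b
  grundy-⊕≡0⇔ a b = All.wfRec (wf S) 0ℓ ZeroRule step (a , b)
    where
    step : ∀ x → (∀ {y} → y ∈ moves S x → ZeroRule y) → ZeroRule x
    step (a , b) ih = mk⇔ ⇒ ⇐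
      where
      ⇒ : grundy S (a , b) ≡ 0 → grundy G₁ a ≡ grundy G₂ b
      ⇒ g≡0 with grundy G₁ a ≟ grundy G₂ b
      ... | yes g₁≡g₂ = g₁≡g₂
      ... | no  g₁≢g₂ = let _ , y∈ , gy≡0 = movableTo-0 ih g₁≢g₂
                        in ⊥-elim (grundy-option-≢ S y∈ (trans gy≡0 (sym g≡0)))

      ⇐ : grundy G₁ a ≡ grundy G₂ b → grundy S (a , b) ≡ 0
      ⇐ g₁≡g₂ = grundy-intro S avoids (λ ())
        where
        avoids : ∀ {y} → y ∈ moves S (a , b) → grundy S y ≢ 0
        avoids y∈ gy≡0 with ⊕-move-view y∈
        ... | left  a′∈ = grundy-option-≢ G₁ a′∈ (trans (to (ih y∈) gy≡0) (sym g₁≡g₂))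
        ... | right b′∈ = grundy-option-≢ G₂ b′∈ (trans (sym (to (ih y∈) gy≡0)) g₁≡g₂)

  grundy-⊕-movableTo-0 : ∀ {a b} → grundy G₁ a ≢ grundy G₂ b →
                         MovableTo S (λ y → grundy S y ≡ 0) (a , b)
  grundy-⊕-movableTo-0 = movableTo-0 λ {y} _ → grundy-⊕≡0⇔ (proj₁ y) (proj₂ y)

  grundy-⊕≡1⇔ : ∀ a b → grundy S (a , b) ≡ 1 ⇔ grundy G₁ a ≡ flip (grundy G₂ b)
  grundy-⊕≡1⇔ a b = All.wfRec (wf S) 0ℓ OneRule step (a , b)
    where
    OneRule : Pos G₁ × Pos G₂ → Set
    OneRule (a , b) = grundy S (a , b) ≡ 1 ⇔ grundy G₁ a ≡ flip (grundy G₂ b)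

    step : ∀ x → (∀ {y} → y ∈ moves S x → OneRule y) → OneRule x
    step (a , b) ih = mk⇔ ⇒ ⇐
      where
      ⇒ : grundy S (a , b) ≡ 1 → grundy G₁ a ≡ flip (grundy G₂ b)
      ⇒ g≡1 with grundy G₁ a ≟ flip (grundy G₂ b)
      ... | yes g₁≡flip = g₁≡flip
      ... | no  g₁≢flip = ⊥-elim (0≢1+n (trans (sym (from (grundy-⊕≡0⇔ a b) g₁≡g₂)) g≡1))
        where
        flip<g₁-impossible : ¬ flip (grundy G₂ b) < grundy G₁ a
        flip<g₁-impossible lt = let _ , a′∈ , g₁′≡flip = grundy-movableTo-< G₁ lt in
          grundy-option-≢ S (⊕-moveˡ a′∈) (trans (from (ih (⊕-moveˡ a′∈)) g₁′≡flip) (sym g≡1))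

        flip<g₂-impossible : ¬ flip (grundy G₁ a) < grundy G₂ b
        flip<g₂-impossible lt = let _ , b′∈ , g₂′≡flip = grundy-movableTo-< G₂ lt in
          grundy-option-≢ S (⊕-moveʳ b′∈) (trans (from (ih (⊕-moveʳ b′∈)) (flip-sym g₂′≡flip)) (sym g≡1))

        g₁≡g₂ : grundy G₁ a ≡ grundy G₂ b
        g₁≡g₂ = ≤-antisym (<flip⇒≤ (≤∧≢⇒< (≮⇒≥ flip<g₁-impossible) g₁≢flip))
                          (<flip⇒≤ (≤∧≢⇒< (≮⇒≥ flip<g₂-impossible) (g₁≢flip ∘ flip-sym)))

      ⇐ : grundy G₁ a ≡ flip (grundy G₂ b) → grundy S (a , b) ≡ 1
      ⇐ g₁≡flip = grundy-intro S avoids reaches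
        where
        avoids : ∀ {y} → y ∈ moves S (a , b) → grundy S y ≢ 1
        avoids y∈ gy≡1 with ⊕-move-view y∈
        ... | left  a′∈ = grundy-option-≢ G₁ a′∈ (trans (to (ih y∈) gy≡1) (sym g₁≡flip))
        ... | right b′∈ = grundy-option-≢ G₂ b′∈ (flip-injective (trans (sym (to (ih y∈) gy≡1)) g₁≡flip))

        reaches : ∀ {k} → k < 1 → MovableTo S (λ y → grundy S y ≡ k) (a , b)
        reaches (s≤s z≤n) = grundy-⊕-movableTo-0 λ g₁≡g₂ → flip-≢ (grundy G₂ b) (trans (sym g₁≡flip) g₁≡g₂)

  grundy-⊕≤1 : ∀ {a b} → grundy G₁ a ≤ 1 → grundy G₂ b ≤ 1 → grundy S (a , b) ≤ 1
  grundy-⊕≤1 {a} {b} g₁≤1 g₂≤1 with grundy G₁ a ≟ grundy G₂ b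
  ... | yes g₁≡g₂ = subst (_≤ 1) (sym (from (grundy-⊕≡0⇔ a b) g₁≡g₂)) z≤n
  ... | no  g₁≢g₂ = subst (_≤ 1) (sym (from (grundy-⊕≡1⇔ a b) (≤1-≢⇒flip g₂≤1 g₁≤1 (g₁≢g₂ ∘ sym)))) (s≤s z≤n)

  grundy-⊕≤1⇒ : ∀ {a b} → grundy S (a , b) ≤ 1 → grundy G₁ a ≤ 1 ⇔ grundy G₂ b ≤ 1
  grundy-⊕≤1⇒ {a} {b} g≤1 with ≤1-cases g≤1
  ... | inj₁ g≡0 = let g₁≡g₂ = to (grundy-⊕≡0⇔ a b) g≡0 in
    mk⇔ (subst (_≤ 1) g₁≡g₂) (subst (_≤ 1) (sym g₁≡g₂))
  ... | inj₂ g≡1 = let g₁≡flip = to (grundy-⊕≡1⇔ a b) g≡1 in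
    mk⇔ (flip-≤1⁻¹ ∘ subst (_≤ 1) g₁≡flip) (subst (_≤ 1) (sym g₁≡flip) ∘ flip-≤1)

  grundy-⊕-cancelʳ : ∀ {a a′ b} → grundy S (a , b) ≡ grundy S (a′ , b) →
                     grundy S (a , b) ≤ 1 → grundy G₁ a ≡ grundy G₁ a′
  grundy-⊕-cancelʳ {a} {a′} {b} eq g≤1 with ≤1-cases g≤1
  ... | inj₁ g≡0 = trans (to (grundy-⊕≡0⇔ a b) g≡0) (sym (to (grundy-⊕≡0⇔ a′ b) (trans (sym eq) g≡0)))
  ... | inj₂ g≡1 = trans (to (grundy-⊕≡1⇔ a b) g≡1) (sym (to (grundy-⊕≡1⇔ a′ b) (trans (sym eq) g≡1)))

  grundy-⊕-cancelˡ : ∀ {a b b′} → grundy S (a , b) ≡ grundy S (a , b′) →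
                     grundy S (a , b) ≤ 1 → grundy G₂ b ≡ grundy G₂ b′
  grundy-⊕-cancelˡ {a} {b} {b′} eq g≤1 with ≤1-cases g≤1
  ... | inj₁ g≡0 = trans (sym (to (grundy-⊕≡0⇔ a b) g≡0)) (to (grundy-⊕≡0⇔ a b′) (trans (sym eq) g≡0))
  ... | inj₂ g≡1 = flip-injective (trans (sym (to (grundy-⊕≡1⇔ a b) g≡1)) (to (grundy-⊕≡1⇔ a b′) (trans (sym eq) g≡1)))

module _ (G₁ G₂ : Game) (M₁ : Miserable G₁) (M₂ : Miserable G₂) where

  private
    S : Game
    S = G₁ ⊕ G₂

  BothSwap : Pos S → Set
  BothSwap (a , b) = Swap G₁ a × Swap G₂ b

  bothSwap? : Decidable BothSwap
  bothSwap? (a , b) = swap? G₁ a ×-dec swap? G₂ b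

  Invariant : Pos S → Set
  Invariant x = (BothSwap x → Swap S x) × (¬ BothSwap x → grundy S x ≡ misere S x)

  Invariant⇒BothSwap : ∀ {x} → Invariant x → Swap S x → BothSwap x
  Invariant⇒BothSwap {x} (_ , ¬both⇒g≡m) sx with bothSwap? x
  ... | yes both  = both
  ... | no  ¬both = ⊥-elim (swap⇒grundy≢misere S sx (¬both⇒g≡m ¬both))

  bothSwap-movableTo : ∀ {x} → BothSwap x → NonTerminal S x → MovableTo S BothSwap x
  bothSwap-movableTo (sa , sb) nt with ⊕-nonterminal⁻ G₁ G₂ nt
  ... | inj₁ nta = let _ , a′∈ , sa′ = swap⇒movableTo-swap G₁ M₁ sa nta in _ , ⊕-moveˡ G₁ G₂ a′∈ , sa′ , sb
  ... | inj₂ ntb = let _ , b′∈ , sb′ = swap⇒movableTo-swap G₂ M₂ sb ntb in _ , ⊕-moveʳ G₁ G₂ b′∈ , sa , sb′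

  bothSwap-option : ∀ {x y} → BothSwap x → y ∈ moves S x → BothSwap y ⊎ (¬ BothSwap y × 1 < grundy S y)
  bothSwap-option (sa , sb) y∈ with ⊕-move-view G₁ G₂ y∈
  ... | left a′∈ with swap-option G₁ M₁ sa a′∈
  ...   | inj₁ sa′   = inj₁ (sa′ , sb)
  ...   | inj₂ 1<g₁′ = inj₂ ((λ (sa′ , _) → <⇒≱ 1<g₁′ (swap-grundy≤1 G₁ sa′)) ,
                             ≰⇒> λ g≤1 → <⇒≱ 1<g₁′ (from (grundy-⊕≤1⇒ G₁ G₂ g≤1) (swap-grundy≤1 G₂ sb)))
  bothSwap-option (sa , sb) y∈ | right b′∈ with swap-option G₂ M₂ sb b′∈
  ...   | inj₁ sb′   = inj₁ (sa , sb′)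
  ...   | inj₂ 1<g₂′ = inj₂ ((λ (_ , sb′) → <⇒≱ 1<g₂′ (swap-grundy≤1 G₂ sb′)) ,
                             ≰⇒> λ g≤1 → <⇒≱ 1<g₂′ (to (grundy-⊕≤1⇒ G₁ G₂ g≤1) (swap-grundy≤1 G₁ sa)))

  bothSwap⇒grundy≤1 : ∀ {x} → BothSwap x → grundy S x ≤ 1
  bothSwap⇒grundy≤1 (sa , sb) = grundy-⊕≤1 G₁ G₂ (swap-grundy≤1 G₁ sa) (swap-grundy≤1 G₂ sb)

  bothSwap-option-misere : ∀ {x y} → Invariant y → BothSwap x → y ∈ moves S x →
                           (BothSwap y × misere S y ≡ grundy S x) ⊎ 1 < misere S y
  bothSwap-option-misere {x} {y} (both⇒swap , ¬both⇒g≡m) both y∈ with bothSwap-option both y∈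
  ... | inj₁ both′         = inj₁ (both′ , (begin
    misere S y               ≡⟨ swap-misere≡flip S (both⇒swap both′) ⟩
    flip (grundy S y)        ≡⟨ cong flip (≤1-≢⇒flip (bothSwap⇒grundy≤1 both) (bothSwap⇒grundy≤1 both′)
                                                     (grundy-option-≢ S y∈ ∘ sym)) ⟩
    flip (flip (grundy S x)) ≡⟨ flip-involutive (grundy S x) ⟩
    grundy S x               ∎))
    where open ≡-Reasoning
  ... | inj₂ (¬both′ , 1<g) = inj₂ (subst (1 <_) (¬both⇒g≡m ¬both′) 1<g)

  bothSwap⇒swap : ∀ {x} → (∀ {y} → y ∈ moves S x → Invariant y) → BothSwap x → Swap S x
  bothSwap⇒swap {x} ih both with terminal? S x
  ... | inj₁ t  = inj₁ (terminal⇒V01 S t)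
  ... | inj₂ nt = swap-intro S g≤1 (misere-intro S nt avoids reaches)
    where
    g≤1 : grundy S x ≤ 1
    g≤1 = bothSwap⇒grundy≤1 both

    avoids : ∀ {y} → y ∈ moves S x → misere S y ≢ flip (grundy S x)
    avoids y∈ my≡flip with bothSwap-option-misere (ih y∈) both y∈
    ... | inj₁ (_ , my≡g) = flip-≢ (grundy S x) (trans (sym my≡flip) my≡g)
    ... | inj₂ 1<my       = <⇒≱ 1<my (subst (_≤ 1) (sym my≡flip) (flip-≤1 g≤1))

    reaches : ∀ {k} → k < flip (grundy S x) → MovableTo S (λ y → misere S y ≡ k) x
    reaches k<flip with y , y∈ , both′ ← bothSwap-movableTo both nt
                   with bothSwap-option-misere (ih y∈) both y∈
    ... | inj₁ (_ , my≡g) = y , y∈ , trans my≡g (sym (<flip-≤1 g≤1 k<flip))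
    ... | inj₂ 1<my       = ⊥-elim (<⇒≱ 1<my (swap-misere≤1 S (proj₁ (ih y∈) both′)))

  nonBothSwap-movableTo : ∀ {x} → (∀ {y} → y ∈ moves S x → Invariant y) → ¬ BothSwap x →
                          MovableTo S (Swap S) x → MovableTo S (V S 0 1) x × MovableTo S (V S 1 0) x
  nonBothSwap-movableTo ih ¬both (y , y∈ , sy) with ⊕-move-view G₁ G₂ y∈ | Invariant⇒BothSwap (ih y∈) sy
  ... | left a′∈ | sa′ , sb =
    let (_ , p₀ , v₀) , (_ , p₁ , v₁) = miserable-movableTo G₁ M₁ (¬both ∘ (_, sb)) (_ , a′∈ , sa′)
        s₀ = proj₁ (ih (⊕-moveˡ G₁ G₂ p₀)) (inj₁ v₀ , sb)
        s₁ = proj₁ (ih (⊕-moveˡ G₁ G₂ p₁)) (inj₂ v₁ , sb)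
    in movableTo-V01×V10 S (⊕-moveˡ G₁ G₂ p₀) (⊕-moveˡ G₁ G₂ p₁) s₀ s₁ λ eq →
         0≢1+n (trans (sym (proj₁ v₀)) (trans (grundy-⊕-cancelʳ G₁ G₂ eq (swap-grundy≤1 S s₀)) (proj₁ v₁)))
  ... | right b′∈ | sa , sb′ =
    let (_ , p₀ , v₀) , (_ , p₁ , v₁) = miserable-movableTo G₂ M₂ (¬both ∘ (sa ,_)) (_ , b′∈ , sb′)
        s₀ = proj₁ (ih (⊕-moveʳ G₁ G₂ p₀)) (sa , inj₁ v₀)
        s₁ = proj₁ (ih (⊕-moveʳ G₁ G₂ p₁)) (sa , inj₂ v₁)
    in movableTo-V01×V10 S (⊕-moveʳ G₁ G₂ p₀) (⊕-moveʳ G₁ G₂ p₁) s₀ s₁ λ eq →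
         0≢1+n (trans (sym (proj₁ v₀)) (trans (grundy-⊕-cancelˡ G₁ G₂ eq (swap-grundy≤1 S s₀)) (proj₁ v₁)))

  nonBothSwap⇒grundy≡misere : ∀ {x} → (∀ {y} → y ∈ moves S x → Invariant y) → ¬ BothSwap x →
                              grundy S x ≡ misere S x
  nonBothSwap⇒grundy≡misere ih ¬both =
    grundy≡misere S (⊕-nonterminal G₁ G₂ ¬both) options (nonBothSwap-movableTo ih ¬both)
    where
    options : ∀ {y} → y ∈ moves S _ → Swap S y ⊎ grundy S y ≡ misere S y
    options {y} y∈ with bothSwap? y
    ... | yes both′  = inj₁ (proj₁ (ih y∈) both′)
    ... | no  ¬both′ = inj₂ (proj₂ (ih y∈) ¬both′)

  invariant : ∀ x → Invariant x
  invariant = All.wfRec (wf S) 0ℓ Invariant λ _ ih → bothSwap⇒swap ih , nonBothSwap⇒grundy≡misere ih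

  ⊕-swap⇔ : ∀ a b → Swap S (a , b) ⇔ (Swap G₁ a × Swap G₂ b)
  ⊕-swap⇔ a b = mk⇔ (Invariant⇒BothSwap (invariant (a , b))) (proj₁ (invariant (a , b)))

  ⊕-miserable : Miserable S
  ⊕-miserable x with swap? S x | movableTo? S (swap? S) x
  ... | yes sx  | _      = inj₁ sx
  ... | no  _   | no ¬mv = inj₂ (inj₁ ¬mv)
  ... | no  ¬sx | yes mv = inj₂ (inj₂ (nonBothSwap-movableTo (λ {y} _ → invariant y) (¬sx ∘ proj₁ (invariant x)) mv))

  ⊕-V10⇔ : ∀ a b → V S 1 0 (a , b) ⇔ ((V G₁ 1 0 a × V G₂ 0 1 b) ⊎ (V G₁ 0 1 a × V G₂ 1 0 b))
  ⊕-V10⇔ a b = mk⇔ ⇒ ⇐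
    where
    g₁≢g₂ : V S 1 0 (a , b) → grundy G₁ a ≢ grundy G₂ b
    g₁≢g₂ v g₁≡g₂ = 0≢1+n (trans (sym (from (grundy-⊕≡0⇔ G₁ G₂ a b) g₁≡g₂)) (proj₁ v))

    ⇒ : V S 1 0 (a , b) → (V G₁ 1 0 a × V G₂ 0 1 b) ⊎ (V G₁ 0 1 a × V G₂ 1 0 b)
    ⇒ v with to (⊕-swap⇔ a b) (inj₂ v)
    ... | inj₁ va , inj₂ vb = inj₂ (va , vb)
    ... | inj₂ va , inj₁ vb = inj₁ (va , vb)
    ... | inj₁ va , inj₁ vb = ⊥-elim (g₁≢g₂ v (trans (proj₁ va) (sym (proj₁ vb))))
    ... | inj₂ va , inj₂ vb = ⊥-elim (g₁≢g₂ v (trans (proj₁ va) (sym (proj₁ vb))))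

    ⇐ : (V G₁ 1 0 a × V G₂ 0 1 b) ⊎ (V G₁ 0 1 a × V G₂ 1 0 b) → V S 1 0 (a , b)
    ⇐ (inj₁ (va , vb)) = swap-V10 S (from (⊕-swap⇔ a b) (inj₂ va , inj₁ vb)) λ g≡0 →
      0≢1+n (trans (sym (proj₁ vb)) (trans (sym (to (grundy-⊕≡0⇔ G₁ G₂ a b) g≡0)) (proj₁ va)))
    ⇐ (inj₂ (va , vb)) = swap-V10 S (from (⊕-swap⇔ a b) (inj₁ va , inj₂ vb)) λ g≡0 →
      0≢1+n (trans (sym (proj₁ va)) (trans (to (grundy-⊕≡0⇔ G₁ G₂ a b) g≡0) (proj₁ vb)))

theorem5p3 : (G₁ G₂ : Game) → Miserable G₁ → Miserable G₂ → Miserable (G₁ ⊕ G₂) × (∀ (x₁ : Pos G₁) (x₂ : Pos G₂) → (Swap (G₁ ⊕ G₂) (x₁ , x₂) ⇔ (Swap G₁ x₁ × Swap G₂ x₂)) × (V (G₁ ⊕ G₂) 1 0 (x₁ , x₂) ⇔ ((V G₁ 1 0 x₁ × V G₂ 0 1 x₂) ⊎ (V G₁ 0 1 x₁ × V G₂ 1 0 x₂))))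
theorem5p3 G₁ G₂ M₁ M₂ = ⊕-miserable G₁ G₂ M₁ M₂ , λ x₁ x₂ → ⊕-swap⇔ G₁ G₂ M₁ M₂ x₁ x₂ , ⊕-V10⇔ G₁ G₂ M₁ M₂ x₁ x₂
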